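{- For $n\ge 1$, \[ \prod_{i=1}^{n}\bigl(1 + t[2i]_q - t\bigr) = \sum_{w\in B_n} q^{\operatorname{sor}_B(w)} t^{\ell'_B(w)}, \] where $[k]_q=1+q+\cdots+q^{k-1}$.
   Context: $B_n$ is the group of signed permutations of $\{\pm1,\ldots,\pm n\}$ (bijections with $w(-i)=-w(i)$), product $(uv)(x)=u(v(x))$; $\bar i=-i$. For $i,j$ with $i\ne\pm j$, $t_{ij}$ exchanges $i\leftrightarrow j$ and $-i\leftrightarrow -j$, fixing the rest; $t_{\bar j j}$ exchanges $j\leftrightarrow -j$, fixing the rest. Let $T^B=\{t_{ij}: 1\le i<j\le n\}\cup\{t_{\bar i j} : 1\le i\le j\le n\}$. The reflection length $\ell'_B(w)$ is the minimal number of elements of $T^B$ whose product is $w$. Every $w\in B_n$ has a unique factorization $w=t_{i_1j_1}\cdots t_{i_kj_k}$ with $0<j_1<\cdots<j_k$, each $i_s\in\{ -j_s,\ldots,j_s-1\}\setminus\{0\}$ (given by a type B straight selection sort). The type B sorting index is $\operatorname{sor}_B(w)=\sum_{s=1}^k \bigl(j_s-i_s-\chi(i_s<0)\bigr)$, where $\chi(i_s<0)$ is $1$ if $i_s<0$ and $0$ otherwise. -}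

module Defs where

open import Level using (Level)
open import Data.Nat as ℕ using (ℕ; zero; suc; _≤_)
open import Data.Integer as ℤ using (ℤ; +_; -[1+_]; ∣_∣; _<?_)
import Data.Integer.Properties as ℤP
open import Data.Bool using (if_then_else_)
open import Data.Fin using (Fin; toℕ)
open import Data.Product using (_×_; _,_; ∃)
open import Data.List as List using (List; []; _∷_; length; map; filter; concatMap; upTo)
open import Data.List.Relation.Unary.All using (All)
open import Data.List.Relation.Unary.Linked using (Linked)
open import Data.List.Membership.Propositional using (_∈_)
open import Data.Vec as Vec using (Vec; tabulate; toList)
open import Relation.Nullary.Decidable using (does)
open import Relation.Binary.PropositionalEquality using (_≡_)
open import Data.List.Relation.Unary.Unique.DecPropositional ℕ._≟_ using (unique?)
open import Algebra.Bundles using (CommutativeRing)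

-- Signed permutations of {±1,…,±n}, in window notation:
-- w is represented by the vector [w(1), …, w(n)] ∈ ℤⁿ; w(-x) = -w(x).

signedRange : ℕ → List ℤ
signedRange n = map -[1+_] (upTo n) List.++ map (λ k → + suc k) (upTo n)

allVecs : {A : Set} → List A → (m : ℕ) → List (Vec A m)
allVecs xs zero    = Vec.[] ∷ []
allVecs xs (suc m) = concatMap (λ x → map (x Vec.∷_) (allVecs xs m)) xs

Bn : (n : ℕ) → List (Vec ℤ n)
Bn n = filter (λ w → unique? (map ∣_∣ (toList w))) (allVecs (signedRange n) n)

-- Reflections t_{ij} (as pairs (i , j) of integers) acting on ℤ.
-- t_{ij} : i ↔ j, -i ↔ -j, rest fixed.  For i = -j this is t_{j̄ j}: j ↔ -j.

refl-act : ℤ × ℤ → ℤ → ℤ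
refl-act (i , j) x =
  if does (x ℤ.≟ i) then j else
  if does (x ℤ.≟ j) then i else
  if does (x ℤ.≟ (ℤ.- i)) then ℤ.- j else
  if does (x ℤ.≟ (ℤ.- j)) then ℤ.- i else x

-- the product t₁ t₂ ⋯ t_k (composition, rightmost acts first), applied to x
applyProd : List (ℤ × ℤ) → ℤ → ℤ
applyProd ts x = List.foldr refl-act x ts

prodWindow : (n : ℕ) → List (ℤ × ℤ) → Vec ℤ n
prodWindow n ts = tabulate (λ (x : Fin n) → applyProd ts (+ suc (toℕ x)))

-- membership in T^B = {t_ij : 1 ≤ i < j ≤ n} ∪ {t_{ī j} : 1 ≤ i ≤ j ≤ n},
-- i.e. pairs (i , j) with 1 ≤ j ≤ n and i ∈ {-j, …, j-1} \ {0}
InTB : ℕ → ℤ × ℤ → Set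
InTB n (i , j) = (+ 1 ℤ.≤ j) × (j ℤ.≤ + n) × (ℤ.- j ℤ.≤ i) × (i ℤ.< j) × (i ≢0)
  where
  open import Relation.Nullary using (¬_)
  _≢0 : ℤ → Set
  k ≢0 = ¬ (k ≡ + 0)

IsReflLength : (n : ℕ) → Vec ℤ n → ℕ → Set
IsReflLength n w k =
  (∃ λ ts → All (InTB n) ts × length ts ≡ k × prodWindow n ts ≡ w)
  × (∀ ts → All (InTB n) ts → prodWindow n ts ≡ w → k ≤ length ts)

IsSortFactorization : (n : ℕ) → Vec ℤ n → List (ℤ × ℤ) → Set
IsSortFactorization n w fs =
  All (InTB n) fs
  × Linked (λ p q → Data.Product.proj₂ p ℤ.< Data.Product.proj₂ q) fs
  × prodWindow n fs ≡ w
  where import Data.Product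

χneg : ℤ → ℤ
χneg i = if does (i <? + 0) then + 1 else + 0

-- sor_B of a factorization: Σ (j_s - i_s - χ(i_s < 0))  (each term is ≥ 1,
-- so taking ∣_∣ only converts to ℕ)
sorOf : List (ℤ × ℤ) → ℕ
sorOf [] = 0
sorOf ((i , j) ∷ fs) = ∣ j ℤ.- i ℤ.- χneg i ∣ ℕ.+ sorOf fs

module RingOps {c ℓ : Level} (R : CommutativeRing c ℓ) where
  open CommutativeRing R

  pow : Carrier → ℕ → Carrier
  pow x zero    = 1#
  pow x (suc k) = x * pow x k

  sumL : List Carrier → Carrier
  sumL = List.foldr _+_ 0#

  prodTo : ℕ → (ℕ → Carrier) → Carrier
  prodTo zero    f = 1#
  prodTo (suc m) f = prodTo m f * f (suc m)

  qint : ℕ → Carrier → Carrier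
  qint k q = sumL (map (pow q) (upTo k))

  lhsB : ℕ → Carrier → Carrier → Carrier
  lhsB n q t = prodTo n (λ i → 1# + t * qint (2 ℕ.* i) q - t)

  rhsB : (n : ℕ) → (Vec ℤ n → ℕ) → (Vec ℤ n → ℕ) → Carrier → Carrier → Carrier
  rhsB n sor ℓ' q t = sumL (map (λ w → pow q (sor w) * pow t (ℓ' w)) (Bn n))

-- Selection sort writes every w ∈ B_n as w = t_{i₁1} ⋯ t_{iₙn}: at level k = n, …, 1 the pivot i_k is
-- the letter that the remaining permutation sends to k, and the pivots range freely over 0 < |i_k| ≤ k.
-- Dropping the trivial factors t_{kk} gives the sorted factorization. Right multiplication by a single
-- reflection changes the number of nontrivial factors by at most one (the remaining permutations differ
-- by a conjugate reflection that fixes ±k), so that number is the reflection length ℓ'_B. Hence sor_B and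
-- ℓ'_B are sums over the levels, and the sum over B_n factors into the sums over the pivots of each level k,
-- which are 1 + t(q + ⋯ + q^{2k-1}) = 1 + t[2k]_q - t.

module Submission where

open import Defs
open import Level using (Level)
open import Algebra.Bundles using (CommutativeRing)
open import Data.Bool using (if_then_else_)
open import Data.Empty using (⊥-elim)
open import Data.Fin as Fin using (Fin; toℕ; fromℕ<)
import Data.Fin.Properties as FinP
open import Data.Integer as ℤ using (ℤ; +_; -[1+_]; ∣_∣; -_; 0ℤ)
import Data.Integer.Properties as ℤP
open import Data.List as List using (List; []; _∷_; length; _++_; _∷ʳ′_)
import Data.List.Properties as ListP
open import Data.List.Membership.Propositional using (_∈_)
import Data.List.Membership.Propositional.Properties as ∈P
open import Data.List.Membership.Propositional.Properties.WithK using (unique∧set⇒bag)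
open import Data.List.Relation.Binary.BagAndSetEquality using (∼bag⇒↭)
open import Data.List.Relation.Binary.Permutation.Propositional using (_↭_; ↭⇒↭ₛ′)
import Data.List.Relation.Binary.Permutation.Propositional.Properties as PermP
import Data.List.Relation.Binary.Permutation.Setoid.Properties as PermSetoid
open import Data.List.Relation.Unary.All as All using (All; []; _∷_)
import Data.List.Relation.Unary.All.Properties as AllP
open import Data.List.Relation.Unary.AllPairs using (AllPairs; []; _∷_)
open import Data.List.Relation.Unary.Any using (here)
open import Data.List.Relation.Unary.Linked using (Linked)
open import Data.List.Relation.Unary.Linked.Properties using (Linked⇒AllPairs)
open import Data.List.Relation.Unary.Unique.Propositional using (Unique)
import Data.List.Relation.Unary.Unique.Propositional.Properties as UniqueP
open import Data.Maybe using (nothing)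
open import Data.Nat as ℕ using (ℕ; zero; suc; _≤_; _<_; z≤n; s≤s)
import Data.Nat.Properties as ℕP
open import Data.Product using (_×_; _,_; proj₁; proj₂; ∃; ∃₂; uncurry)
open import Data.Sum using (_⊎_; inj₁; inj₂)
open import Data.Vec as Vec using (Vec)
import Data.Vec.Properties as VecP
open import Function using (_∘_; id; flip; case_of_)
open import Function.Bundles using (mk⇔)
open import Relation.Nullary using (yes; no; does)
open import Relation.Nullary.Decidable using (dec-true; dec-false; toSum)
open import Relation.Binary.PropositionalEquality
  using (_≡_; _≢_; refl; sym; trans; cong; cong₂; subst; _≗_; ≢-sym; module ≡-Reasoning)
import Tactic.RingSolver.Core.AlmostCommutativeRing as ACR
open import Algebra.Definitions {A = ℤ} _≡_ using (Involutive)
open import Data.List.Relation.Unary.Unique.DecPropositional ℕ._≟_ using (unique?)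

-- Reflections

t : ℤ → ℤ → ℤ → ℤ
t i j = refl-act (i , j)

i≡-i⇒i≡0 : ∀ {i} → i ≡ - i → i ≡ 0ℤ
i≡-i⇒i≡0 {+ zero} _ = refl

-i≢i : ∀ {i} → i ≢ 0ℤ → - i ≢ i
-i≢i i≢0 -i≡i = i≢0 (i≡-i⇒i≡0 (sym -i≡i))

-≢0 : ∀ {i} → i ≢ 0ℤ → - i ≢ 0ℤ
-≢0 {i} i≢0 -i≡0 = i≢0 (ℤP.neg-injective -i≡0)

-‿swap : ∀ {i j} → - i ≡ j → i ≡ - j
-‿swap {i} refl = sym (ℤP.neg-involutive i)

t-at-i : ∀ i j → t i j i ≡ j
t-at-i i j rewrite dec-true (i ℤ.≟ i) refl = refl

t-at-j : ∀ i j → t i j j ≡ i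
t-at-j i j with j ℤ.≟ i
... | yes j≡i = j≡i
... | no _ rewrite dec-true (j ℤ.≟ j) refl = refl

t-at-−i : ∀ {i} j → i ≢ 0ℤ → t i j (- i) ≡ - j
t-at-−i {i} j i≢0 rewrite dec-false (- i ℤ.≟ i) (-i≢i i≢0) with - i ℤ.≟ j
... | yes -i≡j = -‿swap -i≡j
... | no _ rewrite dec-true (- i ℤ.≟ - i) refl = refl

t-at-−j : ∀ i {j} → j ≢ 0ℤ → t i j (- j) ≡ - i
t-at-−j i {j} j≢0 with - j ℤ.≟ i
... | yes -j≡i = -‿swap -j≡i
... | no _ rewrite dec-false (- j ℤ.≟ j) (-i≢i j≢0) with - j ℤ.≟ - i
...   | yes -j≡-i = -j≡-i
...   | no _ rewrite dec-true (- j ℤ.≟ - j) refl = refl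

t-elsewhere : ∀ {i j x} → x ≢ i → x ≢ j → x ≢ - i → x ≢ - j → t i j x ≡ x
t-elsewhere {i} {j} {x} x≢i x≢j x≢-i x≢-j
  rewrite dec-false (x ℤ.≟ i) x≢i | dec-false (x ℤ.≟ j) x≢j
        | dec-false (x ℤ.≟ - i) x≢-i | dec-false (x ℤ.≟ - j) x≢-j = refl

data Hit (i j x : ℤ) : Set where
  at-i  : x ≡ i → Hit i j x
  at-j  : x ≡ j → Hit i j x
  at-−i : x ≡ - i → Hit i j x
  at-−j : x ≡ - j → Hit i j x
  elsewhere : x ≢ i → x ≢ j → x ≢ - i → x ≢ - j → Hit i j x

hit : ∀ i j x → Hit i j x
hit i j x with x ℤ.≟ i | x ℤ.≟ j | x ℤ.≟ - i | x ℤ.≟ - j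
... | yes e | _     | _     | _     = at-i e
... | no _  | yes e | _     | _     = at-j e
... | no _  | no _  | yes e | _     = at-−i e
... | no _  | no _  | no _  | yes e = at-−j e
... | no p  | no q  | no r  | no s  = elsewhere p q r s

t-diag : ∀ i → t i i ≗ id
t-diag i x with x ℤ.≟ i
... | yes x≡i = sym x≡i
... | no _ with x ℤ.≟ - i
...   | yes x≡-i = sym x≡-i
...   | no _ = refl

module _ {i j : ℤ} (i≢0 : i ≢ 0ℤ) (j≢0 : j ≢ 0ℤ) where

  t-involutive : ∀ x → t i j (t i j x) ≡ x
  t-involutive x with hit i j x
  ... | at-i refl  = trans (cong (t i j) (t-at-i i j)) (t-at-j i j)
  ... | at-j refl  = trans (cong (t i j) (t-at-j i j)) (t-at-i i j)
  ... | at-−i refl = trans (cong (t i j) (t-at-−i j i≢0)) (t-at-−j i j≢0)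
  ... | at-−j refl = trans (cong (t i j) (t-at-−j i j≢0)) (t-at-−i j i≢0)
  ... | elsewhere p q r s = trans (cong (t i j) (t-elsewhere p q r s)) (t-elsewhere p q r s)

  t-odd : ∀ x → t i j (- x) ≡ - t i j x
  t-odd x with hit i j x
  ... | at-i refl  = trans (t-at-−i j i≢0) (cong -_ (sym (t-at-i i j)))
  ... | at-j refl  = trans (t-at-−j i j≢0) (cong -_ (sym (t-at-j i j)))
  ... | at-−i refl = begin
    t i j (- - i) ≡⟨ cong (t i j) (ℤP.neg-involutive i) ⟩
    t i j i       ≡⟨ t-at-i i j ⟩
    j             ≡⟨ ℤP.neg-involutive j ⟨
    - - j         ≡⟨ cong -_ (t-at-−i j i≢0) ⟨
    - t i j (- i) ∎
    where open ≡-Reasoning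
  ... | at-−j refl = begin
    t i j (- - j) ≡⟨ cong (t i j) (ℤP.neg-involutive j) ⟩
    t i j j       ≡⟨ t-at-j i j ⟩
    i             ≡⟨ ℤP.neg-involutive i ⟨
    - - i         ≡⟨ cong -_ (t-at-−j i j≢0) ⟨
    - t i j (- j) ∎
    where open ≡-Reasoning
  ... | elsewhere p q r s =
    trans (t-elsewhere (r ∘ -‿swap) (s ∘ -‿swap) (p ∘ ℤP.neg-injective) (q ∘ ℤP.neg-injective))
          (cong -_ (sym (t-elsewhere p q r s)))

-- Odd bijections

record OddBijection (f g : ℤ → ℤ) : Set where
  field
    inverseˡ : ∀ x → f (g x) ≡ x
    inverseʳ : ∀ x → g (f x) ≡ x
    odd      : ∀ x → f (- x) ≡ - f x

  injective : ∀ {x y} → f x ≡ f y → x ≡ y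
  injective {x} {y} fx≡fy = trans (sym (inverseʳ x)) (trans (cong g fx≡fy) (inverseʳ y))

  fixes-0 : f 0ℤ ≡ 0ℤ
  fixes-0 = i≡-i⇒i≡0 (odd 0ℤ)

  ≢0 : ∀ {x} → x ≢ 0ℤ → f x ≢ 0ℤ
  ≢0 x≢0 fx≡0 = x≢0 (injective (trans fx≡0 (sym fixes-0)))

  inverse-odd : ∀ x → g (- x) ≡ - g x
  inverse-odd x = injective (begin
    f (g (- x))   ≡⟨ inverseˡ (- x) ⟩
    - x           ≡⟨ cong -_ (inverseˡ x) ⟨
    - f (g x)     ≡⟨ odd (g x) ⟨
    f (- g x)     ∎)
    where open ≡-Reasoning

  inverse : OddBijection g f
  inverse = record { inverseˡ = inverseʳ ; inverseʳ = inverseˡ ; odd = inverse-odd }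

  commute-t : ∀ {a b} → a ≢ 0ℤ → b ≢ 0ℤ → ∀ y → f (t a b y) ≡ t (f a) (f b) (f y)
  commute-t {a} {b} a≢0 b≢0 y with hit a b y
  ... | at-i refl  = trans (cong f (t-at-i a b)) (sym (t-at-i (f a) (f b)))
  ... | at-j refl  = trans (cong f (t-at-j a b)) (sym (t-at-j (f a) (f b)))
  ... | at-−i refl = begin
    f (t a b (- a))         ≡⟨ cong f (t-at-−i b a≢0) ⟩
    f (- b)                 ≡⟨ odd b ⟩
    - f b                   ≡⟨ t-at-−i (f b) (≢0 a≢0) ⟨
    t (f a) (f b) (- f a)   ≡⟨ cong (t (f a) (f b)) (odd a) ⟨
    t (f a) (f b) (f (- a)) ∎
    where open ≡-Reasoning
  ... | at-−j refl = begin
    f (t a b (- b))         ≡⟨ cong f (t-at-−j a b≢0) ⟩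
    f (- a)                 ≡⟨ odd a ⟩
    - f a                   ≡⟨ t-at-−j (f a) (≢0 b≢0) ⟨
    t (f a) (f b) (- f b)   ≡⟨ cong (t (f a) (f b)) (odd b) ⟨
    t (f a) (f b) (f (- b)) ∎
    where open ≡-Reasoning
  ... | elsewhere p q r s = trans (cong f (t-elsewhere p q r s)) (sym (t-elsewhere
          (p ∘ injective) (q ∘ injective)
          (r ∘ injective ∘ flip trans (sym (odd a))) (s ∘ injective ∘ flip trans (sym (odd b)))))

  conjugate-t : ∀ {a b} → a ≢ 0ℤ → b ≢ 0ℤ → ∀ z → f (t a b (g z)) ≡ t (f a) (f b) z
  conjugate-t a≢0 b≢0 z = trans (commute-t a≢0 b≢0 (g z)) (cong (t _ _) (inverseˡ z))

oddBijection-id : OddBijection id id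
oddBijection-id = record { inverseˡ = λ _ → refl ; inverseʳ = λ _ → refl ; odd = λ _ → refl }

oddBijection-∘ : ∀ {f g h k} → OddBijection f g → OddBijection h k → OddBijection (f ∘ h) (k ∘ g)
oddBijection-∘ {f} {g} {h} {k} F H = record
  { inverseˡ = λ x → trans (cong f (H.inverseˡ (g x))) (F.inverseˡ x)
  ; inverseʳ = λ x → trans (cong k (F.inverseʳ (h x))) (H.inverseʳ x)
  ; odd      = λ x → trans (cong f (H.odd x)) (F.odd (h x))
  }
  where
  module F = OddBijection F
  module H = OddBijection H

oddBijection-neg : OddBijection -_ -_
oddBijection-neg = record
  { inverseˡ = ℤP.neg-involutive ; inverseʳ = ℤP.neg-involutive ; odd = λ _ → refl }

oddBijection-t : ∀ {i j} → i ≢ 0ℤ → j ≢ 0ℤ → OddBijection (t i j) (t i j)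
oddBijection-t i≢0 j≢0 = record
  { inverseˡ = t-involutive i≢0 j≢0
  ; inverseʳ = t-involutive i≢0 j≢0
  ; odd      = t-odd i≢0 j≢0
  }

module _ {i j : ℤ} (i≢0 : i ≢ 0ℤ) (j≢0 : j ≢ 0ℤ) where

  t-sym : t i j ≗ t j i
  t-sym z = begin
    t i j z                 ≡⟨ cong (t i j) (t-involutive i≢0 j≢0 z) ⟨
    t i j (t i j (t i j z)) ≡⟨ conjugate-t i≢0 j≢0 z ⟩
    t (t i j i) (t i j j) z ≡⟨ cong₂ (λ u v → t u v z) (t-at-i i j) (t-at-j i j) ⟩
    t j i z                 ∎
    where
    open ≡-Reasoning
    open OddBijection (oddBijection-t i≢0 j≢0)

  t-neg : t i j ≗ t (- i) (- j)
  t-neg z = begin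
    t i j z           ≡⟨ ℤP.neg-involutive _ ⟨
    - - t i j z       ≡⟨ cong -_ (t-odd i≢0 j≢0 z) ⟨
    - t i j (- z)     ≡⟨ OddBijection.conjugate-t oddBijection-neg i≢0 j≢0 z ⟩
    t (- i) (- j) z   ∎
    where open ≡-Reasoning

t-moved : ∀ {i j z} → i ≢ 0ℤ → j ≢ 0ℤ → t i j z ≢ z → t i j ≗ t (t i j z) z
t-moved {i} {j} {z} i≢0 j≢0 moves w with hit i j z
... | at-i refl  = trans (t-sym i≢0 j≢0 w) (cong (λ u → t u i w) (sym (t-at-i i j)))
... | at-j refl  = cong (λ u → t u j w) (sym (t-at-j i j))
... | at-−i refl = begin
  t i j w                 ≡⟨ t-neg i≢0 j≢0 w ⟩
  t (- i) (- j) w         ≡⟨ t-sym (-≢0 i≢0) (-≢0 j≢0) w ⟩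
  t (- j) (- i) w         ≡⟨ cong (λ u → t u (- i) w) (t-at-−i j i≢0) ⟨
  t (t i j (- i)) (- i) w ∎
  where open ≡-Reasoning
... | at-−j refl = trans (t-neg i≢0 j≢0 w) (cong (λ u → t u (- j) w) (sym (t-at-−j i j≢0)))
... | elsewhere p q r s = ⊥-elim (moves (t-elsewhere p q r s))

-- Signed permutations and selection sort

top : ℕ → ℤ
top m = + suc m

∣x∣<∣y∣⇒x≢y : ∀ {x y} → ∣ x ∣ < ∣ y ∣ → x ≢ y
∣x∣<∣y∣⇒x≢y lt refl = ℕP.<-irrefl refl lt

∣x∣<∣y∣⇒x≢-y : ∀ {x y} → ∣ x ∣ < ∣ y ∣ → x ≢ - y
∣x∣<∣y∣⇒x≢-y {y = y} lt refl = ℕP.<-irrefl (ℤP.∣-i∣≡∣i∣ y) lt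

∣x∣≡1+m⇒x≡±top : ∀ {x m} → ∣ x ∣ ≡ suc m → x ≡ top m ⊎ x ≡ - top m
∣x∣≡1+m⇒x≡±top {+ _}      refl = inj₁ refl
∣x∣≡1+m⇒x≡±top { -[1+ _ ]} refl = inj₂ refl

below-top : ∀ {x m} → ∣ x ∣ ≤ suc m → x ≢ top m → x ≢ - top m → ∣ x ∣ ≤ m
below-top le x≢top x≢-top with ℕP.m≤n⇒m<n∨m≡n le
... | inj₁ lt = ℕP.m<1+n⇒m≤n lt
... | inj₂ eq with ∣x∣≡1+m⇒x≡±top eq
...   | inj₁ x≡top  = ⊥-elim (x≢top x≡top)
...   | inj₂ x≡-top = ⊥-elim (x≢-top x≡-top)

Supported : ℕ → (ℤ → ℤ) → Set
Supported m f = ∀ x → m < ∣ x ∣ → f x ≡ x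

t-supported : ∀ {i j m} → ∣ i ∣ ≤ m → ∣ j ∣ ≤ m → Supported m (t i j)
t-supported i≤m j≤m x m<x = t-elsewhere
  (≢-sym (∣x∣<∣y∣⇒x≢y i<x)) (≢-sym (∣x∣<∣y∣⇒x≢y j<x))
  (∣x∣<∣y∣⇒x≢-y i<x ∘ -‿swap ∘ sym) (∣x∣<∣y∣⇒x≢-y j<x ∘ -‿swap ∘ sym)
  where
  i<x = ℕP.≤-<-trans i≤m m<x
  j<x = ℕP.≤-<-trans j≤m m<x

record SignedPerm (m : ℕ) (f g : ℤ → ℤ) : Set where
  field
    oddBijection : OddBijection f g
    supported    : Supported m f

  open OddBijection oddBijection public

  inverse-supported : Supported m g
  inverse-supported x m<x = trans (cong g (sym (supported x m<x))) (inverseʳ x)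

  bounded : ∀ {x} → ∣ x ∣ ≤ m → ∣ f x ∣ ≤ m
  bounded {x} x≤m = ℕP.≮⇒≥ λ m<fx →
    ℕP.<⇒≱ m<fx (subst (λ y → ∣ y ∣ ≤ m) (trans (sym (inverseʳ x)) (inverse-supported (f x) m<fx)) x≤m)

  inverse-bounded : ∀ {x} → ∣ x ∣ ≤ m → ∣ g x ∣ ≤ m
  inverse-bounded {x} x≤m = ℕP.≮⇒≥ λ m<gx →
    ℕP.<⇒≱ m<gx (subst (λ y → ∣ y ∣ ≤ m) (trans (sym (inverseˡ x)) (supported (g x) m<gx)) x≤m)

signedPerm-∘ : ∀ {m f g h k} → SignedPerm m f g → SignedPerm m h k → SignedPerm m (f ∘ h) (k ∘ g)
signedPerm-∘ {f = f} F H = record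
  { oddBijection = oddBijection-∘ (SignedPerm.oddBijection F) (SignedPerm.oddBijection H)
  ; supported    = λ x m<x → trans (cong f (SignedPerm.supported H x m<x)) (SignedPerm.supported F x m<x)
  }

signedPerm-id : ∀ {m} → SignedPerm m id id
signedPerm-id = record { oddBijection = oddBijection-id ; supported = λ _ _ → refl }

signedPerm-t : ∀ {m i j} → i ≢ 0ℤ → j ≢ 0ℤ → ∣ i ∣ ≤ m → ∣ j ∣ ≤ m →
  SignedPerm m (t i j) (t i j)
signedPerm-t i≢0 j≢0 i≤m j≤m = record
  { oddBijection = oddBijection-t i≢0 j≢0 ; supported = t-supported i≤m j≤m }

pivotFactor : ℤ → ℤ → List (ℤ × ℤ)
pivotFactor i j = if does (i ℤ.≟ j) then [] else (i , j) ∷ []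

pivotFactor-≡ : ∀ j → pivotFactor j j ≡ []
pivotFactor-≡ j rewrite dec-true (j ℤ.≟ j) refl = refl

pivotFactor-≢ : ∀ {i j} → i ≢ j → pivotFactor i j ≡ (i , j) ∷ []
pivotFactor-≢ {i} {j} i≢j rewrite dec-false (i ℤ.≟ j) i≢j = refl

length-pivotFactor-cong : ∀ {i i′ j} → (i ≡ j → i′ ≡ j) → (i′ ≡ j → i ≡ j) →
  length (pivotFactor i′ j) ≡ length (pivotFactor i j)
length-pivotFactor-cong {i} {i′} {j} ⇒ ⇐ with i ℤ.≟ j | i′ ℤ.≟ j
... | yes _   | yes _    = refl
... | no _    | no _     = refl
... | yes i≡j | no i′≢j  = ⊥-elim (i′≢j (⇒ i≡j))
... | no i≢j  | yes i′≡j = ⊥-elim (i≢j (⇐ i′≡j))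

-- The list runs from the top level down: its head g (top m) is the letter that f sends to top m.
sortChoices : ℕ → (ℤ → ℤ) → (ℤ → ℤ) → List ℤ
sortChoices zero    f g = []
sortChoices (suc m) f g =
  g (top m) ∷ sortChoices m (f ∘ t (g (top m)) (top m)) (t (g (top m)) (top m) ∘ g)

factorsOf : ℕ → List ℤ → List (ℤ × ℤ)
factorsOf zero    _       = []
factorsOf (suc m) []      = []
factorsOf (suc m) (i ∷ c) = factorsOf m c ++ pivotFactor i (top m)

factorCount : ℕ → List ℤ → ℕ
factorCount zero    _       = 0
factorCount (suc m) []      = 0
factorCount (suc m) (i ∷ c) = factorCount m c ℕ.+ length (pivotFactor i (top m))

length-factorsOf : ∀ m c → length (factorsOf m c) ≡ factorCount m c
length-factorsOf zero    _       = refl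
length-factorsOf (suc m) []      = refl
length-factorsOf (suc m) (i ∷ c) =
  trans (ListP.length-++ (factorsOf m c)) (cong (ℕ._+ _) (length-factorsOf m c))

sortLength : ℕ → (ℤ → ℤ) → (ℤ → ℤ) → ℕ
sortLength m f g = factorCount m (sortChoices m f g)

sortChoices-cong : ∀ m {f f′ g g′} → f ≗ f′ → g ≗ g′ → sortChoices m f g ≡ sortChoices m f′ g′
sortChoices-cong zero    f≗f′ g≗g′ = refl
sortChoices-cong (suc m) {f} {f′} {g} {g′} f≗f′ g≗g′ = cong₂ _∷_ (g≗g′ M) (sortChoices-cong m
  (λ x → trans (f≗f′ _) (cong (λ i → f′ (t i M x)) (g≗g′ M)))
  (λ x → trans (cong (λ i → t i M (g x)) (g≗g′ M)) (cong (t (g′ M) M) (g≗g′ x))))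
  where M = top m

sortLength-cong : ∀ m {f f′ g g′} → f ≗ f′ → g ≗ g′ → sortLength m f g ≡ sortLength m f′ g′
sortLength-cong m f≗f′ g≗g′ = cong (factorCount m) (sortChoices-cong m f≗f′ g≗g′)

sortLength-id : ∀ m → sortLength m id id ≡ 0
sortLength-id zero    = refl
sortLength-id (suc m) = begin
  sortLength m (t M M) (t M M) ℕ.+ length (pivotFactor M M)
    ≡⟨ cong₂ ℕ._+_ (sortLength-cong m (t-diag M) (t-diag M)) (cong length (pivotFactor-≡ M)) ⟩
  sortLength m id id ℕ.+ 0
    ≡⟨ cong (ℕ._+ 0) (sortLength-id m) ⟩
  0 ∎
  where
  open ≡-Reasoning
  M = top m

module Peel {m f g} (σ : SignedPerm (suc m) f g) where
  open SignedPerm σ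

  M : ℤ
  M = top m

  pivot : ℤ
  pivot = g M

  pivot≢0 : pivot ≢ 0ℤ
  pivot≢0 = OddBijection.≢0 inverse (λ ())

  pivot-bounded : ∣ pivot ∣ ≤ suc m
  pivot-bounded = inverse-bounded ℕP.≤-refl

  rest : SignedPerm m (f ∘ t pivot M) (t pivot M ∘ g)
  rest = record
    { oddBijection = oddBijection-∘ oddBijection (oddBijection-t pivot≢0 λ ())
    ; supported    = fixes-beyond
    }
    where
    fixes-beyond : Supported m (f ∘ t pivot M)
    fixes-beyond x m<x with ℕP.m≤n⇒m<n∨m≡n m<x
    ... | inj₁ 1+m<x = trans (cong f (t-supported pivot-bounded ℕP.≤-refl x 1+m<x)) (supported x 1+m<x)
    ... | inj₂ 1+m≡x with ∣x∣≡1+m⇒x≡±top {x} (sym 1+m≡x)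
    ...   | inj₁ refl = trans (cong f (t-at-j pivot M)) (inverseˡ M)
    ...   | inj₂ refl = begin
      f (t pivot M (- M)) ≡⟨ cong f (t-at-−j pivot {M} λ ()) ⟩
      f (- pivot)         ≡⟨ odd pivot ⟩
      - f (g M)           ≡⟨ cong -_ (inverseˡ M) ⟩
      - M                 ∎
      where open ≡-Reasoning

-- Reflection length

record Reflection (m : ℕ) (x y : ℤ) : Set where
  constructor reflection
  field
    x≢0   : x ≢ 0ℤ
    y≢0   : y ≢ 0ℤ
    x≢y   : x ≢ y
    ∣x∣≤m : ∣ x ∣ ≤ m
    ∣y∣≤m : ∣ y ∣ ≤ m

  signedPerm : SignedPerm m (t x y) (t x y)
  signedPerm = signedPerm-t x≢0 y≢0 ∣x∣≤m ∣y∣≤m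

SortLengthLipschitz : ℕ → Set
SortLengthLipschitz m = ∀ {f g x y} → SignedPerm m f g → Reflection m x y →
  sortLength m (f ∘ t x y) (t x y ∘ g) ≤ suc (sortLength m f g)

reverse-involutions : ∀ {p q r s : ℤ → ℤ} →
  Involutive p → Involutive q → Involutive r → Involutive s → p ∘ q ∘ r ≗ s → r ∘ q ∘ p ≗ s
reverse-involutions {p} {q} {r} {s} p² q² r² s² pqr≗s z = begin
  r (q (p z))                 ≡⟨ s² _ ⟨
  s (s (r (q (p z))))         ≡⟨ cong s (pqr≗s _) ⟨
  s (p (q (r (r (q (p z)))))) ≡⟨ cong (λ w → s (p (q w))) (r² _) ⟩
  s (p (q (q (p z))))         ≡⟨ cong (λ w → s (p w)) (q² _) ⟩
  s (p (p z))                 ≡⟨ cong s (p² z) ⟩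
  s z                         ∎
  where open ≡-Reasoning

t-fixed : ∀ {i j z} → i ≢ 0ℤ → j ≢ 0ℤ → i ≢ j → t i j z ≡ z →
  z ≢ i × z ≢ j × z ≢ - i × z ≢ - j
t-fixed {i} {j} {z} i≢0 j≢0 i≢j fixed with hit i j z
... | at-i refl  = ⊥-elim (i≢j (sym (trans (sym (t-at-i i j)) fixed)))
... | at-j refl  = ⊥-elim (i≢j (trans (sym (t-at-j i j)) fixed))
... | at-−i refl = ⊥-elim (i≢j (sym (ℤP.neg-injective (trans (sym (t-at-−i j i≢0)) fixed))))
... | at-−j refl = ⊥-elim (i≢j (ℤP.neg-injective (trans (sym (t-at-−j i j≢0)) fixed)))
... | elsewhere p q r s = p , q , r , s

t-sign-change : ∀ {a M} → a ≢ 0ℤ → M ≢ 0ℤ → a ≢ M → a ≢ - M →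
  t (- M) M ∘ t a M ∘ t (- a) M ≗ t a (- a)
t-sign-change {a} {M} a≢0 M≢0 a≢M a≢-M z = begin
  σ (t a M (t (- a) M z))             ≡⟨ cong (σ ∘ t a M) (σ² (t (- a) M z)) ⟨
  σ (t a M (σ (σ (t (- a) M z))))     ≡⟨ Σ.conjugate-t a≢0 M≢0 (σ (t (- a) M z)) ⟩
  t (σ a) (σ M) (σ (t (- a) M z))     ≡⟨ cong₂ (λ u v → t u v (σ (t (- a) M z))) σa≡a (t-at-j (- M) M) ⟩
  t a (- M) (σ (t (- a) M z))         ≡⟨ cong (t a (- M) ∘ σ) (t-neg (-≢0 a≢0) M≢0 z) ⟩
  t a (- M) (σ (t (- - a) (- M) z))   ≡⟨ cong (λ u → t a (- M) (σ (t u (- M) z))) (ℤP.neg-involutive a) ⟩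
  t a (- M) (σ (t a (- M) z))         ≡⟨ T.conjugate-t (-≢0 M≢0) M≢0 z ⟩
  t (t a (- M) (- M)) (t a (- M) M) z ≡⟨ cong₂ (λ u v → t u v z) (t-at-j a (- M)) t-a-M-at-M ⟩
  t a (- a) z                         ∎
  where
  open ≡-Reasoning
  σ = t (- M) M
  module Σ = OddBijection (oddBijection-t (-≢0 M≢0) M≢0)
  module T = OddBijection (oddBijection-t a≢0 (-≢0 M≢0))
  σ² = t-involutive (-≢0 M≢0) M≢0
  σa≡a : σ a ≡ a
  σa≡a = t-elsewhere a≢-M a≢M (a≢M ∘ flip trans (ℤP.neg-involutive M)) a≢-M
  t-a-M-at-M : t a (- M) M ≡ - a
  t-a-M-at-M = trans (cong (t a (- M)) (sym (ℤP.neg-involutive M))) (t-at-−j a (-≢0 M≢0))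

sign-change-reflection : ∀ {m a} → a ≢ 0ℤ → ∣ a ∣ ≤ suc m → a ≢ top m → a ≢ - top m →
  Reflection m a (- a)
sign-change-reflection {m} {a} a≢0 a≤ a≢M a≢-M =
  reflection a≢0 (-≢0 a≢0) (-i≢i a≢0 ∘ sym) a≤m (subst (_≤ m) (sym (ℤP.∣-i∣≡∣i∣ a)) a≤m)
  where a≤m = below-top a≤ a≢M a≢-M

-- `toSum` keeps `with` from abstracting the equality tests hidden inside `t a (top m) i`.
lower-reflection : ∀ {m a i} → a ≢ 0ℤ → i ≢ 0ℤ → a ≢ top m → i ≢ top m → i ≢ a →
  ∣ a ∣ ≤ suc m → ∣ i ∣ ≤ suc m →
  ∃₂ λ u v → Reflection m u v × (t i (top m) ∘ t a (top m) ∘ t (t a (top m) i) (top m) ≗ t u v)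
lower-reflection {m} {a} {i} a≢0 i≢0 a≢M i≢M i≢a a≤ i≤
  with toSum (i ℤ.≟ - top m) | toSum (i ℤ.≟ - a)
... | inj₁ refl | _ = a , - a , sign-change-reflection a≢0 a≤ a≢M a≢-M , λ z →
  trans (cong (λ u → t (- M) M (t a M (t u M z))) (t-at-−j a {M} λ ()))
        (t-sign-change a≢0 (λ ()) a≢M a≢-M z)
  where
  M = top m
  a≢-M : a ≢ - M
  a≢-M = i≢a ∘ sym
... | inj₂ i≢-M | inj₁ refl = a , - a , sign-change-reflection a≢0 a≤ a≢M a≢-M , λ z →
  trans (cong (λ u → t (- a) M (t a M (t u M z))) (t-at-−i M a≢0))
        (reverse-involutions {t (- M) M} {t a M} {t (- a) M} {t a (- a)}
           (t-involutive (-≢0 M≢0) M≢0) (t-involutive a≢0 M≢0) (t-involutive (-≢0 a≢0) M≢0)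
           (t-involutive a≢0 (-≢0 a≢0)) (t-sign-change a≢0 M≢0 a≢M a≢-M) z)
  where
  M = top m
  M≢0 : M ≢ 0ℤ
  M≢0 ()
  a≢-M : a ≢ - M
  a≢-M a≡-M = i≢M (trans (cong -_ a≡-M) (ℤP.neg-involutive M))
... | inj₂ i≢-M | inj₂ i≢-a = u , i , reflection u≢0 i≢0 u≢i u≤m i≤m , λ z →
  trans (cong (λ w → t i M (t a M (t w M z))) i′≡i)
        (trans (Ti.conjugate-t a≢0 M≢0 z) (cong (λ w → t u w z) (t-at-j i M)))
  where
  M = top m
  M≢0 : M ≢ 0ℤ
  M≢0 ()
  module Ti = SignedPerm (signedPerm-t {suc m} i≢0 M≢0 i≤ ℕP.≤-refl)
  u = t i M a
  i′≡i : t a M i ≡ i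
  i′≡i = t-elsewhere i≢a i≢M i≢-a i≢-M
  u≢0 : u ≢ 0ℤ
  u≢0 = Ti.≢0 a≢0
  u≢i : u ≢ i
  u≢i u≡i = a≢M (Ti.injective (trans u≡i (sym (t-at-j i M))))
  i≤m : ∣ i ∣ ≤ m
  i≤m = below-top i≤ i≢M i≢-M
  u≤m : ∣ u ∣ ≤ m
  u≤m = below-top (Ti.bounded {a} a≤)
    (λ u≡M → i≢a (sym (Ti.injective (trans u≡M (sym (t-at-i i M))))))
    (λ u≡-M → i≢-a (-‿swap (sym (Ti.injective (trans u≡-M (sym (t-at-−i M i≢0)))))))

module _ {m : ℕ} (IH : SortLengthLipschitz m) {f g : ℤ → ℤ} (σ : SignedPerm (suc m) f g) where
  open SignedPerm σ
  open Peel σ using (M; pivot; pivot≢0; pivot-bounded; rest)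
  open ℕP.≤-Reasoning

  private
    i = pivot
    h = f ∘ t i M
    h⁻ = t i M ∘ g

    M≢0 : M ≢ 0ℤ
    M≢0 ()

  -- The pivot of f t_{aM} is i′ = t_{aM} i, after which f t_{aM} t_{i′M} is f t_{iM} times the
  -- reflection t_{iM} t_{aM} t_{i′M} of lower rank, unless i = M or i = a.
  sortLength-∘t-moving : ∀ {a} → a ≢ 0ℤ → a ≢ M → ∣ a ∣ ≤ suc m →
    sortLength (suc m) (f ∘ t a M) (t a M ∘ g) ≤ suc (sortLength (suc m) f g)
  sortLength-∘t-moving {a} a≢0 a≢M a≤ with toSum (i ℤ.≟ M) | toSum (i ℤ.≟ a)
  ... | inj₁ i≡M | _ = ℕP.≤-reflexive (begin-equality
    sortLength m (f ∘ t a M ∘ t i′ M) (t i′ M ∘ t a M ∘ g) ℕ.+ length (pivotFactor i′ M)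
      ≡⟨ cong₂ ℕ._+_ (sortLength-cong m (λ z → cong f (undo z)) (λ z → undo′ (g z)))
                     (cong length (trans (cong (λ u → pivotFactor u M) i′≡a) (pivotFactor-≢ a≢M))) ⟩
    sortLength m f g ℕ.+ 1
      ≡⟨ ℕP.+-comm _ 1 ⟩
    suc (sortLength m f g)
      ≡⟨ cong suc (sortLength-cong m (λ z → cong f (t-id z)) (t-id ∘ g)) ⟨
    suc (sortLength m h h⁻)
      ≡⟨ cong suc (ℕP.+-identityʳ _) ⟨
    suc (sortLength m h h⁻ ℕ.+ 0)
      ≡⟨ cong (λ k → suc (sortLength m h h⁻ ℕ.+ k))
              (cong length (trans (cong (λ u → pivotFactor u M) i≡M) (pivotFactor-≡ M))) ⟨
    suc (sortLength m h h⁻ ℕ.+ length (pivotFactor i M)) ∎)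
    where
    i′ = t a M i
    i′≡a : i′ ≡ a
    i′≡a = trans (cong (t a M) i≡M) (t-at-j a M)
    undo : t a M ∘ t i′ M ≗ id
    undo z = trans (cong (λ u → t a M (t u M z)) i′≡a) (t-involutive a≢0 M≢0 z)
    undo′ : t i′ M ∘ t a M ≗ id
    undo′ z = trans (cong (λ u → t u M (t a M z)) i′≡a) (t-involutive a≢0 M≢0 z)
    t-id : t i M ≗ id
    t-id z = trans (cong (λ u → t u M z) i≡M) (t-diag M z)
  ... | inj₂ i≢M | inj₁ i≡a = begin
    sortLength m (f ∘ t a M ∘ t i′ M) (t i′ M ∘ t a M ∘ g) ℕ.+ length (pivotFactor i′ M)
      ≡⟨ cong₂ ℕ._+_ (sortLength-cong m (λ z → cong f (collapse z)) (λ z → collapse′ (g z)))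
                     (cong length (trans (cong (λ u → pivotFactor u M) i′≡M) (pivotFactor-≡ M))) ⟩
    sortLength m h h⁻ ℕ.+ 0
      ≡⟨ ℕP.+-identityʳ _ ⟩
    sortLength m h h⁻
      ≤⟨ ℕP.m≤n⇒m≤1+n (ℕP.m≤m+n _ _) ⟩
    suc (sortLength m h h⁻ ℕ.+ length (pivotFactor i M)) ∎
    where
    i′ = t a M i
    i′≡M : i′ ≡ M
    i′≡M = trans (cong (t a M) i≡a) (t-at-i a M)
    collapse : t a M ∘ t i′ M ≗ t i M
    collapse z = trans (cong (λ u → t a M (t u M z)) i′≡M)
                       (trans (cong (t a M) (t-diag M z)) (cong (λ u → t u M z) (sym i≡a)))
    collapse′ : t i′ M ∘ t a M ≗ t i M
    collapse′ z = trans (cong (λ u → t u M (t a M z)) i′≡M)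
                        (trans (t-diag M (t a M z)) (cong (λ u → t u M z) (sym i≡a)))
  ... | inj₂ i≢M | inj₂ i≢a with lower-reflection a≢0 pivot≢0 a≢M i≢M i≢a a≤ pivot-bounded
  ...   | u , v , ρ , W = begin
    sortLength m (f ∘ t a M ∘ t i′ M) (t i′ M ∘ t a M ∘ g) ℕ.+ length (pivotFactor i′ M)
      ≡⟨ cong₂ ℕ._+_ (sortLength-cong m (λ z → cong f (W≗ z)) W⁻≗)
                     (cong length (pivotFactor-≢ i′≢M)) ⟩
    sortLength m (h ∘ t u v) (t u v ∘ h⁻) ℕ.+ 1
      ≤⟨ ℕP.+-monoˡ-≤ 1 (IH rest ρ) ⟩
    suc (sortLength m h h⁻) ℕ.+ 1
      ≡⟨ cong (λ k → suc (sortLength m h h⁻ ℕ.+ k)) (cong length (pivotFactor-≢ i≢M)) ⟨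
    suc (sortLength m h h⁻ ℕ.+ length (pivotFactor i M)) ∎
    where
    i′ = t a M i
    Ta = oddBijection-t a≢0 M≢0
    i′≢M : i′ ≢ M
    i′≢M i′≡M = i≢a (OddBijection.injective Ta (trans i′≡M (sym (t-at-i a M))))
    i′≢0 : i′ ≢ 0ℤ
    i′≢0 = OddBijection.≢0 Ta pivot≢0
    W≗ : t a M ∘ t i′ M ≗ t i M ∘ t u v
    W≗ z = trans (sym (t-involutive pivot≢0 M≢0 _)) (cong (t i M) (W z))
    W⁻≗ : t i′ M ∘ t a M ∘ g ≗ t u v ∘ h⁻
    W⁻≗ z = trans (cong (t i′ M ∘ t a M) (sym (t-involutive pivot≢0 M≢0 (g z))))
      (reverse-involutions {t i M} {t a M} {t i′ M} {t u v}
        (t-involutive pivot≢0 M≢0) (t-involutive a≢0 M≢0) (t-involutive i′≢0 M≢0)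
        (t-involutive (Reflection.x≢0 ρ) (Reflection.y≢0 ρ)) W (h⁻ z))

  sortLength-∘t-fixing : ∀ {x y} → Reflection (suc m) x y → t x y M ≡ M →
    sortLength (suc m) (f ∘ t x y) (t x y ∘ g) ≤ suc (sortLength (suc m) f g)
  sortLength-∘t-fixing {x} {y} ρ fixes = begin
    sortLength m (f ∘ r ∘ t i′ M) (t i′ M ∘ r ∘ g) ℕ.+ length (pivotFactor i′ M)
      ≡⟨ cong₂ ℕ._+_ (sortLength-cong m (λ z → cong f (pull z)) (push ∘ g))
                     (length-pivotFactor-cong {i} {i′} (λ i≡M → trans (cong r i≡M) fixes)
                                              (λ i′≡M → R.injective (trans i′≡M (sym fixes)))) ⟩
    sortLength m (h ∘ r) (r ∘ h⁻) ℕ.+ length (pivotFactor i M)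
      ≤⟨ ℕP.+-monoˡ-≤ _ (IH rest ρ′) ⟩
    suc (sortLength m h h⁻ ℕ.+ length (pivotFactor i M)) ∎
    where
    r = t x y
    module ρ = Reflection ρ
    module R = SignedPerm ρ.signedPerm
    i′ = r i
    i′≢0 : i′ ≢ 0ℤ
    i′≢0 = R.≢0 pivot≢0
    pull : r ∘ t i′ M ≗ t i M ∘ r
    pull z = trans (R.commute-t i′≢0 M≢0 z) (cong₂ (λ u v → t u v (r z)) (R.inverseˡ i) fixes)
    push : t i′ M ∘ r ≗ r ∘ t i M
    push z = sym (trans (R.commute-t pivot≢0 M≢0 z) (cong (λ v → t i′ v (r z)) fixes))
    ρ′ : Reflection m x y
    ρ′ with t-fixed ρ.x≢0 ρ.y≢0 ρ.x≢y fixes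
    ... | M≢x , M≢y , M≢-x , M≢-y = reflection ρ.x≢0 ρ.y≢0 ρ.x≢y
      (below-top ρ.∣x∣≤m (≢-sym M≢x) (M≢-x ∘ -‿swap ∘ sym))
      (below-top ρ.∣y∣≤m (≢-sym M≢y) (M≢-y ∘ -‿swap ∘ sym))

sortLength-lipschitz : ∀ m → SortLengthLipschitz m
sortLength-lipschitz zero    _ _ = z≤n
sortLength-lipschitz (suc m) {f} {g} {x} {y} σ ρ with toSum (t x y (top m) ℤ.≟ top m)
... | inj₁ fixes = sortLength-∘t-fixing (sortLength-lipschitz m) σ ρ fixes
... | inj₂ moves = subst (_≤ suc (sortLength (suc m) f g))
  (sortLength-cong (suc m) (λ z → cong f (sym (r≗ z))) (λ z → sym (r≗ (g z))))
  (sortLength-∘t-moving (sortLength-lipschitz m) σ (R.≢0 {top m} λ ()) moves (R.bounded {top m} ℕP.≤-refl))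
  where
  module ρ = Reflection ρ
  module R = SignedPerm ρ.signedPerm
  r≗ = t-moved ρ.x≢0 ρ.y≢0 moves

Reflections : ℕ → List (ℤ × ℤ) → Set
Reflections m = All (uncurry (Reflection m))

applyProdInv : List (ℤ × ℤ) → ℤ → ℤ
applyProdInv ts x = List.foldl (flip refl-act) x ts

applyProd-++ : ∀ xs ys → applyProd (xs ++ ys) ≗ applyProd xs ∘ applyProd ys
applyProd-++ xs ys x = ListP.foldr-++ refl-act x xs ys

applyProdInv-++ : ∀ xs ys → applyProdInv (xs ++ ys) ≗ applyProdInv ys ∘ applyProdInv xs
applyProdInv-++ xs ys x = ListP.foldl-++ (flip refl-act) x xs ys

applyProd-pivotFactor : ∀ i j → applyProd (pivotFactor i j) ≗ t i j
applyProd-pivotFactor i j x with i ℤ.≟ j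
... | yes refl = sym (t-diag i x)
... | no _     = refl

applyProdInv-pivotFactor : ∀ i j → applyProdInv (pivotFactor i j) ≗ t i j
applyProdInv-pivotFactor i j x with i ℤ.≟ j
... | yes refl = sym (t-diag i x)
... | no _     = refl

signedPerm-applyProd : ∀ {m ts} → Reflections m ts → SignedPerm m (applyProd ts) (applyProdInv ts)
signedPerm-applyProd []      = signedPerm-id
signedPerm-applyProd (ρ ∷ ρs) = signedPerm-∘ (Reflection.signedPerm ρ) (signedPerm-applyProd ρs)

sortLength-∘applyProd : ∀ {m f g ts} → SignedPerm m f g → Reflections m ts →
  sortLength m (f ∘ applyProd ts) (applyProdInv ts ∘ g) ≤ length ts ℕ.+ sortLength m f g
sortLength-∘applyProd         σ []       = ℕP.≤-refl
sortLength-∘applyProd {m} {f} {g} {(x , y) ∷ ts} σ (ρ ∷ ρs) = begin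
  sortLength m (f ∘ t x y ∘ applyProd ts) (applyProdInv ts ∘ t x y ∘ g)
    ≤⟨ sortLength-∘applyProd (signedPerm-∘ σ (Reflection.signedPerm ρ)) ρs ⟩
  length ts ℕ.+ sortLength m (f ∘ t x y) (t x y ∘ g)
    ≤⟨ ℕP.+-monoʳ-≤ (length ts) (sortLength-lipschitz m σ ρ) ⟩
  length ts ℕ.+ suc (sortLength m f g)
    ≡⟨ ℕP.+-suc (length ts) _ ⟩
  suc (length ts) ℕ.+ sortLength m f g ∎
  where open ℕP.≤-Reasoning

sortLength-applyProd : ∀ {m ts} → Reflections m ts → sortLength m (applyProd ts) (applyProdInv ts) ≤ length ts
sortLength-applyProd {m} {ts} ρs = begin
  sortLength m (applyProd ts) (applyProdInv ts) ≤⟨ sortLength-∘applyProd signedPerm-id ρs ⟩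
  length ts ℕ.+ sortLength m id id              ≡⟨ cong (length ts ℕ.+_) (sortLength-id m) ⟩
  length ts ℕ.+ 0                               ≡⟨ ℕP.+-identityʳ _ ⟩
  length ts                                     ∎
  where open ℕP.≤-Reasoning

-- Choice vectors and sorted factorizations

data Choices : ℕ → List ℤ → Set where
  []   : Choices 0 []
  _∷_  : ∀ {m i c} → i ≢ 0ℤ × ∣ i ∣ ≤ suc m → Choices m c → Choices (suc m) (i ∷ c)

reflection-mono : ∀ {m n x y} → m ≤ n → Reflection m x y → Reflection n x y
reflection-mono m≤n (reflection x≢0 y≢0 x≢y x≤m y≤m) =
  reflection x≢0 y≢0 x≢y (ℕP.≤-trans x≤m m≤n) (ℕP.≤-trans y≤m m≤n)

reflections-pivotFactor : ∀ {m i} → i ≢ 0ℤ → ∣ i ∣ ≤ suc m →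
  Reflections (suc m) (pivotFactor i (top m))
reflections-pivotFactor {m} {i} i≢0 i≤ with i ℤ.≟ top m
... | yes _   = []
... | no i≢M  = reflection i≢0 (λ ()) i≢M i≤ ℕP.≤-refl ∷ []

reflections-factorsOf : ∀ {m c} → Choices m c → Reflections m (factorsOf m c)
reflections-factorsOf []                 = []
reflections-factorsOf ((i≢0 , i≤) ∷ κ) =
  AllP.++⁺ (All.map (reflection-mono (ℕP.n≤1+n _)) (reflections-factorsOf κ))
           (reflections-pivotFactor i≢0 i≤)

sortChoices-factorsOf : ∀ {m c} → Choices m c →
  sortChoices m (applyProd (factorsOf m c)) (applyProdInv (factorsOf m c)) ≡ c
sortChoices-factorsOf [] = refl
sortChoices-factorsOf {suc m} {i ∷ c} ((i≢0 , i≤) ∷ κ) =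
  cong₂ _∷_ pivot≡i (trans (sortChoices-cong m peelˡ peelʳ) (sortChoices-factorsOf κ))
  where
  M = top m
  fs = factorsOf m c
  P = applyProd (fs ++ pivotFactor i M)
  Q = applyProdInv (fs ++ pivotFactor i M)
  M≢0 : M ≢ 0ℤ
  M≢0 ()
  Q≗ : Q ≗ t i M ∘ applyProdInv fs
  Q≗ x = trans (applyProdInv-++ fs _ x) (applyProdInv-pivotFactor i M _)
  pivot≡i : Q M ≡ i
  pivot≡i = trans (Q≗ M) (trans (cong (t i M)
    (SignedPerm.inverse-supported (signedPerm-applyProd (reflections-factorsOf κ)) M ℕP.≤-refl)) (t-at-j i M))
  peelˡ : P ∘ t (Q M) M ≗ applyProd fs
  peelˡ z = begin
    P (t (Q M) M z)
      ≡⟨ applyProd-++ fs _ _ ⟩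
    applyProd fs (applyProd (pivotFactor i M) (t (Q M) M z))
      ≡⟨ cong (applyProd fs) (applyProd-pivotFactor i M _) ⟩
    applyProd fs (t i M (t (Q M) M z))
      ≡⟨ cong (λ u → applyProd fs (t i M (t u M z))) pivot≡i ⟩
    applyProd fs (t i M (t i M z))
      ≡⟨ cong (applyProd fs) (t-involutive i≢0 M≢0 z) ⟩
    applyProd fs z ∎
    where open ≡-Reasoning
  peelʳ : t (Q M) M ∘ Q ≗ applyProdInv fs
  peelʳ z = begin
    t (Q M) M (Q z)                   ≡⟨ cong (λ u → t u M (Q z)) pivot≡i ⟩
    t i M (Q z)                       ≡⟨ cong (t i M) (Q≗ z) ⟩
    t i M (t i M (applyProdInv fs z)) ≡⟨ t-involutive i≢0 M≢0 _ ⟩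
    applyProdInv fs z                 ∎
    where open ≡-Reasoning

signedPerm-ext : ∀ {n f g f′ g′} → SignedPerm n f g → SignedPerm n f′ g′ →
  (∀ (k : Fin n) → f (+ suc (toℕ k)) ≡ f′ (+ suc (toℕ k))) → f ≗ f′ × g ≗ g′
signedPerm-ext {n} {f} {g} {f′} {g′} σ σ′ window = f≗f′ , g≗g′
  where
  module σ  = SignedPerm σ
  module σ′ = SignedPerm σ′
  positive : ∀ k → f (+ suc k) ≡ f′ (+ suc k)
  positive k with k ℕP.<? n
  ... | yes k<n = subst (λ l → f (+ suc l) ≡ f′ (+ suc l)) (FinP.toℕ-fromℕ< k<n) (window (fromℕ< k<n))
  ... | no k≮n  = trans (σ.supported _ n<k) (sym (σ′.supported _ n<k))
    where n<k = s≤s (ℕP.≮⇒≥ k≮n)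
  f≗f′ : f ≗ f′
  f≗f′ (+ zero)  = trans σ.fixes-0 (sym σ′.fixes-0)
  f≗f′ (+ suc k) = positive k
  f≗f′ -[1+ k ]  = trans (σ.odd (+ suc k)) (trans (cong -_ (positive k)) (sym (σ′.odd (+ suc k))))
  g≗g′ : g ≗ g′
  g≗g′ x = trans (cong g (sym (σ′.inverseˡ x))) (trans (cong g (sym (f≗f′ (g′ x)))) (σ.inverseʳ (g′ x)))

same-window : ∀ {n ts ts′} → Reflections n ts → Reflections n ts′ →
  prodWindow n ts ≡ prodWindow n ts′ → applyProd ts ≗ applyProd ts′ × applyProdInv ts ≗ applyProdInv ts′
same-window {n} {ts} {ts′} ρs ρs′ eq =
  signedPerm-ext (signedPerm-applyProd ρs) (signedPerm-applyProd ρs′) λ k →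
  trans (sym (VecP.lookup∘tabulate (window ts) k))
        (trans (cong (λ w → Vec.lookup w k) eq) (VecP.lookup∘tabulate (window ts′) k))
  where
  window : List (ℤ × ℤ) → Fin n → ℤ
  window ts k = applyProd ts (+ suc (toℕ k))

factorsOf-injective : ∀ {n c c′} → Choices n c → Choices n c′ →
  prodWindow n (factorsOf n c) ≡ prodWindow n (factorsOf n c′) → c ≡ c′
factorsOf-injective {n} κ κ′ eq = trans (sym (sortChoices-factorsOf κ)) (trans
  (uncurry (sortChoices-cong n) (same-window (reflections-factorsOf κ) (reflections-factorsOf κ′) eq))
  (sortChoices-factorsOf κ′))

∣i∣≤k : ∀ {i k} → - + k ℤ.≤ i → i ℤ.< + k → ∣ i ∣ ≤ k
∣i∣≤k {+ _}      {k}     _              (ℤ.+<+ i<k) = ℕP.<⇒≤ i<k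
∣i∣≤k { -[1+ _ ]} {suc k} (ℤ.-≤- i≤k) _            = s≤s i≤k

InTB⇒Reflection : ∀ {n i j} → InTB n (i , j) → Reflection n i j
InTB⇒Reflection {n} {i} {+ suc k} (_ , ℤ.+≤+ k<n , -j≤i , i<j , i≢0) =
  reflection i≢0 (λ ()) (ℤP.<⇒≢ i<j) (ℕP.≤-trans (∣i∣≤k -j≤i i<j) k<n) k<n
InTB⇒Reflection {j = + zero} (ℤ.+≤+ () , _)

InTB-lower : ∀ {n i j} → InTB (suc n) (i , j) → j ℤ.< top n → InTB n (i , j)
InTB-lower (1≤j , _ , -j≤i , i<j , i≢0) j<top = 1≤j , <1+⇒≤ j<top , -j≤i , i<j , i≢0
  where
  <1+⇒≤ : ∀ {j n} → j ℤ.< + suc n → j ℤ.≤ + n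
  <1+⇒≤ (ℤ.+<+ (s≤s j≤n)) = ℤ.+≤+ j≤n
  <1+⇒≤ ℤ.-<+             = ℤ.-≤+

_<ⱼ_ : ℤ × ℤ → ℤ × ℤ → Set
p <ⱼ q = proj₂ p ℤ.< proj₂ q

allPairs-∷ʳ⁻ : ∀ {A : Set} {R : A → A → Set} xs {x} → AllPairs R (xs List.∷ʳ x) →
  AllPairs R xs × All (λ y → R y x) xs
allPairs-∷ʳ⁻ []       _          = [] , []
allPairs-∷ʳ⁻ (y ∷ xs) (Ry ∷ Rxs) =
  let Rxs′ , Rx = allPairs-∷ʳ⁻ xs Rxs
      Ry′ , Ryx = AllP.∷ʳ⁻ Ry
  in Ry′ ∷ Rxs′ , Ryx ∷ Rx

sorted⇒choices : ∀ n {fs} → All (InTB n) fs → AllPairs _<ⱼ_ fs →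
  ∃ λ c → Choices n c × factorsOf n c ≡ fs
sorted⇒choices zero    {[]} _ _ = [] , [] , refl
sorted⇒choices zero    ((1≤j , j≤0 , _) ∷ _) _ with ℤP.≤-trans 1≤j j≤0
... | ℤ.+≤+ ()
sorted⇒choices (suc n) {fs} tbs sorted with List.initLast fs
... | [] =
  let c , κ , eq = sorted⇒choices n [] []
  in top n ∷ c , ((λ ()) , ℕP.≤-refl) ∷ κ , cong₂ _++_ eq (pivotFactor-≡ (top n))
... | fs′ ∷ʳ′ (i , j) with allPairs-∷ʳ⁻ fs′ sorted | AllP.∷ʳ⁻ tbs | j ℤ.≟ top n
...   | sorted′ , below-j | tbs′ , tb | yes refl =
  let c , κ , eq = sorted⇒choices n (All.zipWith (uncurry InTB-lower) (tbs′ , below-j)) sorted′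
      ρ = InTB⇒Reflection tb
  in i ∷ c , (Reflection.x≢0 ρ , Reflection.∣x∣≤m ρ) ∷ κ , cong₂ _++_ eq (pivotFactor-≢ (Reflection.x≢y ρ))
...   | sorted′ , below-j | tbs′ , tb | no j≢top =
  let c , κ , eq = sorted⇒choices n tbs-lowered sorted
  in top n ∷ c , ((λ ()) , ℕP.≤-refl) ∷ κ ,
     trans (cong₂ _++_ eq (pivotFactor-≡ (top n))) (ListP.++-identityʳ _)
  where
  j<top : j ℤ.< top n
  j<top = ℤP.≤∧≢⇒< (proj₁ (proj₂ tb)) j≢top
  tbs-lowered : All (InTB n) (fs′ List.∷ʳ (i , j))
  tbs-lowered = AllP.∷ʳ⁺ (All.zipWith (λ (tb′ , p<j) → InTB-lower tb′ (ℤP.<-trans p<j j<top)) (tbs′ , below-j))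
                         (InTB-lower tb j<top)

sortFactorization⇒choices : ∀ {n w fs} → IsSortFactorization n w fs →
  ∃ λ c → Choices n c × factorsOf n c ≡ fs
sortFactorization⇒choices {n} (tbs , linked , _) = sorted⇒choices n tbs (Linked⇒AllPairs ℤP.<-trans linked)

reflLength≡length : ∀ {n w ℓ fs} → IsReflLength n w ℓ → IsSortFactorization n w fs → ℓ ≡ length fs
reflLength≡length {n} {fs = fs} ((ts , tbs , refl , ts-win) , minimal) sf@(fs-tbs , _ , fs-win)
  with sortFactorization⇒choices sf
... | c , κ , eq = ℕP.≤-antisym (minimal fs fs-tbs fs-win) (begin
    length fs                                       ≡⟨ cong length eq ⟨
    length (factorsOf n c)                          ≡⟨ length-factorsOf n c ⟩
    factorCount n c                                 ≡⟨ cong (factorCount n) (sortChoices-factorsOf κ) ⟨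
    sortLength n (applyProd fs′) (applyProdInv fs′) ≡⟨ uncurry (sortLength-cong n) (same-window ρs ρs-ts windows) ⟩
    sortLength n (applyProd ts) (applyProdInv ts)   ≤⟨ sortLength-applyProd ρs-ts ⟩
    length ts                                       ∎)
  where
  open ℕP.≤-Reasoning
  fs′ = factorsOf n c
  ρs = reflections-factorsOf κ
  ρs-ts = All.map InTB⇒Reflection tbs
  windows : prodWindow n fs′ ≡ prodWindow n ts
  windows = trans (cong (prodWindow n) eq) (trans fs-win (sym ts-win))

-- Enumeration of B_n

∈-signedRange⁺ : ∀ {k i} → i ≢ 0ℤ → ∣ i ∣ ≤ k → i ∈ signedRange k
∈-signedRange⁺ {k} {+ zero}   i≢0 _  = ⊥-elim (i≢0 refl)
∈-signedRange⁺ {k} {+ suc _}  _   i≤ =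
  ∈P.∈-++⁺ʳ (List.map -[1+_] (List.upTo k)) (∈P.∈-map⁺ _ (∈P.∈-upTo⁺ i≤))
∈-signedRange⁺ {k} { -[1+ _ ]} _  i≤ = ∈P.∈-++⁺ˡ (∈P.∈-map⁺ -[1+_] (∈P.∈-upTo⁺ i≤))

∈-signedRange⁻ : ∀ {k i} → i ∈ signedRange k → i ≢ 0ℤ × ∣ i ∣ ≤ k
∈-signedRange⁻ {k} i∈ with ∈P.∈-++⁻ (List.map -[1+_] (List.upTo k)) i∈
... | inj₁ i∈neg with ∈P.∈-map⁻ -[1+_] i∈neg
...   | _ , a∈ , refl = (λ ()) , ∈P.∈-upTo⁻ a∈
∈-signedRange⁻ {k} i∈ | inj₂ i∈pos with ∈P.∈-map⁻ (λ a → + suc a) i∈pos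
...   | _ , a∈ , refl = (λ ()) , ∈P.∈-upTo⁻ a∈

signedRange-unique : ∀ k → Unique (signedRange k)
signedRange-unique k = UniqueP.++⁺
  (UniqueP.map⁺ (λ { refl → refl }) (UniqueP.upTo⁺ k))
  (UniqueP.map⁺ (λ { refl → refl }) (UniqueP.upTo⁺ k))
  λ (i∈neg , i∈pos) → case (∈P.∈-map⁻ -[1+_] i∈neg , ∈P.∈-map⁻ (λ a → + suc a) i∈pos) of λ
    { ((_ , _ , refl) , (_ , _ , ())) }

choiceVectors : ℕ → List (List ℤ)
choiceVectors zero    = [] ∷ []
choiceVectors (suc m) = List.cartesianProductWith _∷_ (signedRange (suc m)) (choiceVectors m)

∈-choiceVectors⁺ : ∀ {m c} → Choices m c → c ∈ choiceVectors m
∈-choiceVectors⁺ []                 = here refl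
∈-choiceVectors⁺ ((i≢0 , i≤) ∷ κ) =
  ∈P.∈-cartesianProductWith⁺ _∷_ (∈-signedRange⁺ i≢0 i≤) (∈-choiceVectors⁺ κ)

∈-choiceVectors⁻ : ∀ {m c} → c ∈ choiceVectors m → Choices m c
∈-choiceVectors⁻ {zero}  (here refl) = []
∈-choiceVectors⁻ {suc m} c∈ with ∈P.∈-cartesianProductWith⁻ _∷_ (signedRange (suc m)) (choiceVectors m) c∈
... | _ , _ , i∈ , c′∈ , refl = ∈-signedRange⁻ i∈ ∷ ∈-choiceVectors⁻ c′∈

choiceVectors-unique : ∀ m → Unique (choiceVectors m)
choiceVectors-unique zero    = [] ∷ []
choiceVectors-unique (suc m) =
  UniqueP.cartesianProductWith⁺ _∷_ ListP.∷-injective (signedRange-unique (suc m)) (choiceVectors-unique m)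

concatMap-map≡cartesianProductWith : ∀ {A B C : Set} (f : A → B → C) xs ys →
  List.concatMap (λ x → List.map (f x) ys) xs ≡ List.cartesianProductWith f xs ys
concatMap-map≡cartesianProductWith f []       ys = refl
concatMap-map≡cartesianProductWith f (x ∷ xs) ys =
  cong (List.map (f x) ys ++_) (concatMap-map≡cartesianProductWith f xs ys)

allVecs-unique : ∀ {A : Set} {xs : List A} m → Unique xs → Unique (allVecs xs m)
allVecs-unique zero              _  = [] ∷ []
allVecs-unique {xs = xs} (suc m) xs! = subst Unique (sym (concatMap-map≡cartesianProductWith Vec._∷_ xs (allVecs xs m)))
  (UniqueP.cartesianProductWith⁺ Vec._∷_ VecP.∷-injective xs! (allVecs-unique m xs!))

∈-allVecs⁺ : ∀ {A : Set} {xs : List A} {m} (v : Vec A m) → (∀ k → Vec.lookup v k ∈ xs) → v ∈ allVecs xs m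
∈-allVecs⁺ Vec.[] _ = here refl
∈-allVecs⁺ {xs = xs} {suc m} (x Vec.∷ v) v⊆xs = subst (_ ∈_) (sym (concatMap-map≡cartesianProductWith Vec._∷_ xs (allVecs xs m)))
  (∈P.∈-cartesianProductWith⁺ Vec._∷_ (v⊆xs Fin.zero) (∈-allVecs⁺ v (v⊆xs ∘ Fin.suc)))

Bn-unique : ∀ n → Unique (Bn n)
Bn-unique n = UniqueP.filter⁺ _ (allVecs-unique n (signedRange-unique n))

∣x∣≡∣y∣⇒x≡±y : ∀ {x y} → ∣ x ∣ ≡ ∣ y ∣ → x ≡ y ⊎ x ≡ - y
∣x∣≡∣y∣⇒x≡±y {+ _}      {+ _}      refl = inj₁ refl
∣x∣≡∣y∣⇒x≡±y {+ _}      { -[1+ _ ]} refl = inj₂ refl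
∣x∣≡∣y∣⇒x≡±y { -[1+ _ ]} {+ _}      refl = inj₂ refl
∣x∣≡∣y∣⇒x≡±y { -[1+ _ ]} { -[1+ _ ]} refl = inj₁ refl

toList-tabulate : ∀ {A : Set} n (h : Fin n → A) → Vec.toList (Vec.tabulate h) ≡ List.tabulate h
toList-tabulate zero    h = refl
toList-tabulate (suc n) h = cong (h Fin.zero ∷_) (toList-tabulate n (h ∘ Fin.suc))

window∈Bn : ∀ {n ts} → Reflections n ts → prodWindow n ts ∈ Bn n
window∈Bn {n} {ts} ρs = ∈P.∈-filter⁺ (λ w → unique? (List.map ∣_∣ (Vec.toList w)))
  (∈-allVecs⁺ _ entries) distinct-abs
  where
  module σ = SignedPerm (signedPerm-applyProd ρs)
  h : Fin n → ℤ
  h k = applyProd ts (+ suc (toℕ k))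
  entries : ∀ k → Vec.lookup (prodWindow n ts) k ∈ signedRange n
  entries k = subst (_∈ signedRange n) (sym (VecP.lookup∘tabulate h k))
    (∈-signedRange⁺ (σ.≢0 λ ()) (σ.bounded (FinP.toℕ<n k)))
  h-injective-abs : ∀ {a b} → ∣ h a ∣ ≡ ∣ h b ∣ → a ≡ b
  h-injective-abs {a} {b} eq with ∣x∣≡∣y∣⇒x≡±y eq
  ... | inj₁ ha≡hb  = FinP.toℕ-injective (ℕP.suc-injective (ℤP.+-injective (σ.injective ha≡hb)))
  ... | inj₂ ha≡-hb with σ.injective (trans ha≡-hb (sym (σ.odd _)))
  ...   | ()
  distinct-abs : Unique (List.map ∣_∣ (Vec.toList (prodWindow n ts)))
  distinct-abs = subst Unique
    (sym (trans (cong (List.map ∣_∣) (toList-tabulate n h)) (ListP.map-tabulate h ∣_∣)))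
    (UniqueP.tabulate⁺ h-injective-abs)

map-unique : ∀ {A B : Set} {P : A → Set} (f : A → B) {xs} → Unique xs → All P xs →
  (∀ {x y} → P x → P y → f x ≡ f y → x ≡ y) → Unique (List.map f xs)
map-unique f []          []         _   = []
map-unique f (x∉ ∷ xs!) (px ∷ pxs) inj =
  AllP.map⁺ (All.zipWith (λ (x≢y , py) fx≡fy → x≢y (inj px py fx≡fy)) (x∉ , pxs)) ∷ map-unique f xs! pxs inj

choiceWindow : (n : ℕ) → List ℤ → Vec ℤ n
choiceWindow n c = prodWindow n (factorsOf n c)

sortFactorization-unique : ∀ {n c fs} → Choices n c → IsSortFactorization n (choiceWindow n c) fs →
  fs ≡ factorsOf n c
sortFactorization-unique {n} {c} κ sf@(_ , _ , fs-win) =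
  let c′ , κ′ , eq = sortFactorization⇒choices sf
  in trans (sym eq) (cong (factorsOf n) (factorsOf-injective κ′ κ (trans (cong (prodWindow n) eq) fs-win)))

Bn↭choiceWindows : ∀ {n} → (∀ w → w ∈ Bn n → ∃ (IsSortFactorization n w)) →
  Bn n ↭ List.map (choiceWindow n) (choiceVectors n)
Bn↭choiceWindows {n} sortable = ∼bag⇒↭ (unique∧set⇒bag (Bn-unique n)
  (map-unique (choiceWindow n) (choiceVectors-unique n) (All.tabulate ∈-choiceVectors⁻) factorsOf-injective)
  (mk⇔ to from))
  where
  to : ∀ {w} → w ∈ Bn n → w ∈ List.map (choiceWindow n) (choiceVectors n)
  to {w} w∈ with sortable w w∈
  ... | fs , sf@(_ , _ , fs-win) with sortFactorization⇒choices sf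
  ...   | c , κ , eq = subst (_∈ _) (trans (cong (prodWindow n) eq) fs-win)
                               (∈P.∈-map⁺ (choiceWindow n) (∈-choiceVectors⁺ κ))
  from : ∀ {w} → w ∈ List.map (choiceWindow n) (choiceVectors n) → w ∈ Bn n
  from w∈ with ∈P.∈-map⁻ (choiceWindow n) w∈
  ... | c , c∈ , refl = window∈Bn (reflections-factorsOf (∈-choiceVectors⁻ c∈))

-- Generating function

applyUpTo-+ : ∀ {a} {A : Set a} (f : ℕ → A) m n →
  List.applyUpTo f (m ℕ.+ n) ≡ List.applyUpTo f m ++ List.applyUpTo (λ x → f (m ℕ.+ x)) n
applyUpTo-+ f zero    n = refl
applyUpTo-+ f (suc m) n = cong (f 0 ∷_) (applyUpTo-+ (f ∘ suc) m n)

sorOf-++ : ∀ xs ys → sorOf (xs ++ ys) ≡ sorOf xs ℕ.+ sorOf ys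
sorOf-++ []             ys = refl
sorOf-++ ((i , j) ∷ xs) ys = trans (cong (_ ℕ.+_) (sorOf-++ xs ys)) (sym (ℕP.+-assoc _ (sorOf xs) (sorOf ys)))

sorOf-negative : ∀ m a → sorOf ((-[1+ a ] , top m) ∷ []) ≡ suc m ℕ.+ a
sorOf-negative m a = trans (ℕP.+-identityʳ _) (ℕP.+-suc m a)

sorOf-positive : ∀ {m a} → a ≤ m → sorOf ((+ suc a , top m) ∷ []) ≡ m ℕ.∸ a
sorOf-positive a≤m = trans (ℕP.+-identityʳ _) (cong ∣_∣ (trans (ℤP.+-identityʳ _) (ℤP.⊖-≥ (s≤s a≤m))))

module Sums {c ℓ : Level} (R : CommutativeRing c ℓ) where
  open CommutativeRing R renaming
    (refl to ≈-refl; sym to ≈-sym; trans to ≈-trans; reflexive to ≈-reflexive; -_ to -ᴿ_; setoid to ≈-setoid)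
  open RingOps R
  open import Relation.Binary.Reasoning.Setoid ≈-setoid

  sum-++ : ∀ xs ys → sumL (xs ++ ys) ≈ sumL xs + sumL ys
  sum-++ []       ys = ≈-sym (+-identityˡ _)
  sum-++ (x ∷ xs) ys = ≈-trans (+-congˡ (sum-++ xs ys)) (≈-sym (+-assoc _ _ _))

  sum-↭ : ∀ {xs ys} → xs ↭ ys → sumL xs ≈ sumL ys
  sum-↭ xs↭ys = PermSetoid.foldr-commMonoid ≈-setoid +-isCommutativeMonoid (↭⇒↭ₛ′ isEquivalence xs↭ys)

  sum-map-++ : ∀ {A : Set} (f : A → Carrier) xs ys →
    sumL (List.map f (xs ++ ys)) ≈ sumL (List.map f xs) + sumL (List.map f ys)
  sum-map-++ f xs ys = ≈-trans (≈-reflexive (cong sumL (ListP.map-++ f xs ys))) (sum-++ (List.map f xs) _)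

  sum-map-cong : ∀ {A : Set} {f g : A → Carrier} → (∀ x → f x ≈ g x) → ∀ xs →
    sumL (List.map f xs) ≈ sumL (List.map g xs)
  sum-map-cong f≈g []       = ≈-refl
  sum-map-cong f≈g (x ∷ xs) = +-cong (f≈g x) (sum-map-cong f≈g xs)

  sum-map-*ˡ : ∀ {A : Set} (a : Carrier) (f : A → Carrier) xs →
    sumL (List.map (λ x → a * f x) xs) ≈ a * sumL (List.map f xs)
  sum-map-*ˡ a f []       = ≈-sym (zeroʳ a)
  sum-map-*ˡ a f (x ∷ xs) = ≈-trans (+-congˡ (sum-map-*ˡ a f xs)) (≈-sym (distribˡ a _ _))

  sum-map-*ʳ : ∀ {A : Set} (f : A → Carrier) (a : Carrier) xs →
    sumL (List.map (λ x → f x * a) xs) ≈ sumL (List.map f xs) * a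
  sum-map-*ʳ f a []       = ≈-sym (zeroˡ a)
  sum-map-*ʳ f a (x ∷ xs) = ≈-trans (+-congˡ (sum-map-*ʳ f a xs)) (≈-sym (distribʳ a _ _))

  sum-cartesianProductWith : ∀ {A B C : Set} (f : A → B → C) {h : C → Carrier}
    {a : A → Carrier} {b : B → Carrier} → (∀ x y → h (f x y) ≈ a x * b y) → ∀ xs ys →
    sumL (List.map h (List.cartesianProductWith f xs ys)) ≈ sumL (List.map a xs) * sumL (List.map b ys)
  sum-cartesianProductWith f h≈ab []       ys = ≈-sym (zeroˡ _)
  sum-cartesianProductWith f {h} {a} {b} h≈ab (x ∷ xs) ys = begin
    sumL (List.map h (List.map (f x) ys ++ List.cartesianProductWith f xs ys))
      ≈⟨ sum-map-++ h (List.map (f x) ys) _ ⟩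
    sumL (List.map h (List.map (f x) ys)) + sumL (List.map h (List.cartesianProductWith f xs ys))
      ≈⟨ +-cong row (sum-cartesianProductWith f h≈ab xs ys) ⟩
    a x * sumL (List.map b ys) + sumL (List.map a xs) * sumL (List.map b ys)
      ≈⟨ distribʳ _ _ _ ⟨
    (a x + sumL (List.map a xs)) * sumL (List.map b ys) ∎
    where
    row : sumL (List.map h (List.map (f x) ys)) ≈ a x * sumL (List.map b ys)
    row = ≈-trans (≈-reflexive (cong sumL (sym (ListP.map-∘ ys))))
                  (≈-trans (sum-map-cong (h≈ab x) ys) (sum-map-*ˡ (a x) b ys))

  pow-+ : ∀ x a b → pow x (a ℕ.+ b) ≈ pow x a * pow x b
  pow-+ x zero    b = ≈-sym (*-identityˡ _)
  pow-+ x (suc a) b = ≈-trans (*-congˡ (pow-+ x a b)) (≈-sym (*-assoc _ _ _))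

  series : (ℕ → Carrier) → ℕ → Carrier
  series f n = sumL (List.applyUpTo f n)

  sum-map-upTo : ∀ (f : ℕ → Carrier) n → sumL (List.map f (List.upTo n)) ≡ series f n
  sum-map-upTo f n = cong sumL (ListP.map-upTo f n)

  series-cong< : ∀ {f g : ℕ → Carrier} {n} → (∀ {a} → a < n → f a ≈ g a) → series f n ≈ series g n
  series-cong< {n = zero}  _   = ≈-refl
  series-cong< {n = suc n} f≈g = +-cong (f≈g (s≤s z≤n)) (series-cong< (f≈g ∘ s≤s))

  series-*ʳ : ∀ (f : ℕ → Carrier) a n → series (λ x → f x * a) n ≈ series f n * a
  series-*ʳ f a n = begin
    series (λ x → f x * a) n                      ≡⟨ sum-map-upTo _ n ⟨
    sumL (List.map (λ x → f x * a) (List.upTo n)) ≈⟨ sum-map-*ʳ f a (List.upTo n) ⟩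
    sumL (List.map f (List.upTo n)) * a           ≡⟨ cong (_* a) (sum-map-upTo f n) ⟩
    series f n * a                                ∎

  series-+ : ∀ (f : ℕ → Carrier) a b → series f (a ℕ.+ b) ≈ series f a + series (λ x → f (a ℕ.+ x)) b
  series-+ f a b = ≈-trans (≈-reflexive (cong sumL (applyUpTo-+ f a b))) (sum-++ (List.applyUpTo f a) _)

  series-last : ∀ (f : ℕ → Carrier) n → series f (suc n) ≈ series f n + f n
  series-last f n = begin
    series f (suc n)                      ≡⟨ cong sumL (ListP.applyUpTo-∷ʳ f n) ⟨
    sumL (List.applyUpTo f n ++ f n ∷ []) ≈⟨ sum-++ (List.applyUpTo f n) _ ⟩
    series f n + (f n + 0#)               ≈⟨ +-congˡ (+-identityʳ _) ⟩
    series f n + f n                      ∎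

  series-reverse : ∀ (f : ℕ → Carrier) n → series (λ a → f (n ℕ.∸ a)) n ≈ series (f ∘ suc) n
  series-reverse f zero    = ≈-refl
  series-reverse f (suc n) = begin
    f (suc n) + series (λ a → f (n ℕ.∸ a)) n ≈⟨ +-congˡ (series-reverse f n) ⟩
    f (suc n) + series (f ∘ suc) n           ≈⟨ +-comm _ _ ⟩
    series (f ∘ suc) n + f (suc n)           ≈⟨ series-last (f ∘ suc) n ⟨
    series (f ∘ suc) (suc n)                 ∎

module GeneratingFunction {c ℓ : Level} (R : CommutativeRing c ℓ) (q τ : CommutativeRing.Carrier R) where
  open CommutativeRing R renaming
    (refl to ≈-refl; sym to ≈-sym; trans to ≈-trans; reflexive to ≈-reflexive; -_ to -ᴿ_; setoid to ≈-setoid)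
  open RingOps R
  open Sums R
  open import Algebra.Properties.CommutativeSemigroup *-commutativeSemigroup using (interchange)
  open import Relation.Binary.Reasoning.Setoid ≈-setoid
  open import Tactic.RingSolver.NonReflective (ACR.fromCommutativeRing R (λ _ → nothing))
    using (solve; _⊜_; _⊕_; _⊗_; ⊝_)

  weight : List (ℤ × ℤ) → Carrier
  weight fs = pow q (sorOf fs) * pow τ (length fs)

  weight-++ : ∀ xs ys → weight (xs ++ ys) ≈ weight xs * weight ys
  weight-++ xs ys = begin
    pow q (sorOf (xs ++ ys)) * pow τ (length (xs ++ ys))
      ≡⟨ cong₂ (λ a b → pow q a * pow τ b) (sorOf-++ xs ys) (ListP.length-++ xs) ⟩
    pow q (sorOf xs ℕ.+ sorOf ys) * pow τ (length xs ℕ.+ length ys)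
      ≈⟨ *-cong (pow-+ q (sorOf xs) (sorOf ys)) (pow-+ τ (length xs) (length ys)) ⟩
    (pow q (sorOf xs) * pow q (sorOf ys)) * (pow τ (length xs) * pow τ (length ys))
      ≈⟨ interchange _ _ _ _ ⟩
    weight xs * weight ys ∎

  pivotWeight : ℕ → ℤ → Carrier
  pivotWeight m i = weight (pivotFactor i (top m))

  pivotWeight-negative : ∀ m a → pivotWeight m -[1+ a ] ≈ pow q (suc m ℕ.+ a) * τ
  pivotWeight-negative m a = ≈-trans (≈-reflexive (cong (λ k → pow q k * (τ * 1#)) (sorOf-negative m a)))
                                     (*-congˡ (*-identityʳ τ))

  pivotWeight-positive : ∀ {m a} → a < m → pivotWeight m (+ suc a) ≈ pow q (m ℕ.∸ a) * τ
  pivotWeight-positive {m} {a} a<m = begin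
    weight (pivotFactor (+ suc a) (top m))
      ≡⟨ cong weight (pivotFactor-≢ (ℕP.<⇒≢ a<m ∘ ℕP.suc-injective ∘ ℤP.+-injective)) ⟩
    pow q (sorOf ((+ suc a , top m) ∷ [])) * (τ * 1#)
      ≡⟨ cong (λ k → pow q k * (τ * 1#)) (sorOf-positive (ℕP.<⇒≤ a<m)) ⟩
    pow q (m ℕ.∸ a) * (τ * 1#)
      ≈⟨ *-congˡ (*-identityʳ τ) ⟩
    pow q (m ℕ.∸ a) * τ ∎

  pivotWeight-top : ∀ m → pivotWeight m (top m) ≈ 1#
  pivotWeight-top m = ≈-trans (≈-reflexive (cong weight (pivotFactor-≡ (top m)))) (*-identityʳ 1#)

  pivotWeights : ∀ m →
    sumL (List.map (pivotWeight m) (signedRange (suc m))) ≈ 1# + τ * qint (2 ℕ.* suc m) q - τ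
  pivotWeights m = begin
    sumL (List.map (pivotWeight m) (negatives ++ positives))
      ≈⟨ sum-map-++ (pivotWeight m) negatives positives ⟩
    sumL (List.map (pivotWeight m) negatives) + sumL (List.map (pivotWeight m) positives)
      ≡⟨ cong₂ _+_ (over-upTo -[1+_]) (over-upTo (λ a → + suc a)) ⟩
    series (λ a → pivotWeight m -[1+ a ]) k + series (λ a → pivotWeight m (+ suc a)) k
      ≈⟨ +-cong negative-sum (series-last _ m) ⟩
    Y * τ + (series (λ a → pivotWeight m (+ suc a)) m + pivotWeight m (top m))
      ≈⟨ +-congˡ (+-cong positive-sum (pivotWeight-top m)) ⟩
    Y * τ + (X * τ + 1#)
      ≈⟨ +-identityʳ _ ⟨
    Y * τ + (X * τ + 1#) + 0#
      ≈⟨ +-congˡ (≈-trans (+-congʳ (*-identityʳ τ)) (-‿inverseʳ τ)) ⟨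
    Y * τ + (X * τ + 1#) + (τ * 1# - τ)
      ≈⟨ solve 5 (λ τ X Y o t → (o ⊕ τ ⊗ ((o ⊕ X) ⊕ Y) ⊕ ⊝ t) ⊜ ((Y ⊗ τ ⊕ (X ⊗ τ ⊕ o)) ⊕ (τ ⊗ o ⊕ ⊝ t)))
                 ≈-refl τ X Y 1# τ ⟨
    1# + τ * ((1# + X) + Y) - τ
      ≈⟨ +-congʳ (+-congˡ (*-congˡ (series-+ (pow q) k k))) ⟨
    1# + τ * series (pow q) (k ℕ.+ k) - τ
      ≡⟨ cong (λ x → 1# + τ * x - τ) qint≡series ⟨
    1# + τ * qint (2 ℕ.* k) q - τ ∎
    where
    k = suc m
    negatives = List.map -[1+_] (List.upTo k)
    positives = List.map (λ a → + suc a) (List.upTo k)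
    X = series (pow q ∘ suc) m
    Y = series (λ a → pow q (k ℕ.+ a)) k
    over-upTo : (g : ℕ → ℤ) →
      sumL (List.map (pivotWeight m) (List.map g (List.upTo k))) ≡ series (pivotWeight m ∘ g) k
    over-upTo g = trans (cong sumL (sym (ListP.map-∘ (List.upTo k)))) (sum-map-upTo _ k)
    negative-sum : series (λ a → pivotWeight m -[1+ a ]) k ≈ Y * τ
    negative-sum = ≈-trans
      (series-cong< {g = λ a → pow q (k ℕ.+ a) * τ} {k} (λ {a} _ → pivotWeight-negative m a))
      (series-*ʳ (λ a → pow q (k ℕ.+ a)) τ k)
    positive-sum : series (λ a → pivotWeight m (+ suc a)) m ≈ X * τ
    positive-sum = ≈-trans
      (series-cong< {g = λ a → pow q (m ℕ.∸ a) * τ} pivotWeight-positive)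
      (≈-trans (series-*ʳ (λ a → pow q (m ℕ.∸ a)) τ m) (*-congʳ (series-reverse (pow q) m)))
    qint≡series : qint (2 ℕ.* k) q ≡ series (pow q) (k ℕ.+ k)
    qint≡series =
      trans (sum-map-upTo (pow q) (2 ℕ.* k)) (cong (series (pow q) ∘ (k ℕ.+_)) (ℕP.+-identityʳ k))

  choiceWeights : ∀ n → sumL (List.map (weight ∘ factorsOf n) (choiceVectors n)) ≈ lhsB n q τ
  choiceWeights zero    = ≈-trans (+-identityʳ _) (*-identityʳ 1#)
  choiceWeights (suc m) = begin
    sumL (List.map (weight ∘ factorsOf (suc m))
                   (List.cartesianProductWith _∷_ (signedRange (suc m)) (choiceVectors m)))
      ≈⟨ sum-cartesianProductWith (List._∷_ {A = ℤ}) {a = pivotWeight m} {b = weight ∘ factorsOf m}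
           (λ i c → ≈-trans (weight-++ (factorsOf m c) (pivotFactor i (top m))) (*-comm _ _))
           (signedRange (suc m)) (choiceVectors m) ⟩
    sumL (List.map (pivotWeight m) (signedRange (suc m))) * sumL (List.map (weight ∘ factorsOf m) (choiceVectors m))
      ≈⟨ *-cong (pivotWeights m) (choiceWeights m) ⟩
    (1# + τ * qint (2 ℕ.* suc m) q - τ) * lhsB m q τ
      ≈⟨ *-comm _ _ ⟩
    lhsB (suc m) q τ ∎

corollary3p4 : (n : ℕ) → 1 ≤ n →
    (ℓ' : Vec ℤ n → ℕ) → (∀ w → w ∈ Bn n → IsReflLength n w (ℓ' w)) →
    (fact : Vec ℤ n → List (ℤ × ℤ)) →
    (∀ w → w ∈ Bn n → IsSortFactorization n w (fact w)) →
    ∀ {c l : Level} (R : CommutativeRing c l) (q t : CommutativeRing.Carrier R) →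
    CommutativeRing._≈_ R (RingOps.lhsB R n q t)
      (RingOps.rhsB R n (λ w → sorOf (fact w)) ℓ' q t)
corollary3p4 n _ ℓ′ isReflLength fact isSortFactorization R q τ = begin
  lhsB n q τ
    ≈⟨ choiceWeights n ⟨
  sumL (List.map (weight ∘ factorsOf n) (choiceVectors n))
    ≡⟨ cong sumL (ListP.map-cong-local (All.tabulate (weights-agree ∘ ∈-choiceVectors⁻))) ⟩
  sumL (List.map (term ∘ choiceWindow n) (choiceVectors n))
    ≡⟨ cong sumL (ListP.map-∘ (choiceVectors n)) ⟩
  sumL (List.map term (List.map (choiceWindow n) (choiceVectors n)))
    ≈⟨ sum-↭ (PermP.map⁺ term (Bn↭choiceWindows λ w w∈ → fact w , isSortFactorization w w∈)) ⟨
  rhsB n (sorOf ∘ fact) ℓ′ q τ ∎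
  where
  open CommutativeRing R using (_*_; _≈_; setoid)
  open RingOps R
  open Sums R using (sum-↭)
  open GeneratingFunction R q τ using (weight; choiceWeights)
  open import Relation.Binary.Reasoning.Setoid setoid
  term : Vec ℤ n → CommutativeRing.Carrier R
  term w = pow q (sorOf (fact w)) * pow τ (ℓ′ w)
  weights-agree : ∀ {c} → Choices n c → weight (factorsOf n c) ≡ term (choiceWindow n c)
  weights-agree κ =
    cong₂ (λ fs k → pow q (sorOf fs) * pow τ k) (sym fact≡) (trans (cong length (sym fact≡)) (sym ℓ′≡))
    where
    w∈ = window∈Bn (reflections-factorsOf κ)
    fact≡ = sortFactorization-unique κ (isSortFactorization _ w∈)
    ℓ′≡ = reflLength≡length (isReflLength _ w∈) (isSortFactorization _ w∈)
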